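{- Let $X$ be a set of $n$ cards and $(a,b,c)=(3,n-4,1)$ with $n-4\ge1$. Suppose Alice's $(3,n-4,1)$-strategy is equitable, informative for Bob, and perfectly $1$-secure against Cathy, and fix one of its announcements $\mathcal{A}_i$. Then for any distinct $x,y\in X$, $N(x)\setminus\{y\} = N(y)\setminus\{x\}$, where neighborhoods are taken with respect to $\mathcal{A}_i$.
   Context: An $(a,b,c)$-deal is a uniformly random partition of $X$ into Alice's hand $H_A$ ($a$ cards), Bob's hand $H_B$ ($b$ cards) and Cathy's hand $H_C$ ($c$ cards). An announcement is a set of $a$-subsets of $X$ (hands). An $(a,b,c)$-strategy consists of announcements $\mathcal{A}_1,\dots,\mathcal{A}_m$ covering all $a$-subsets of $X$ together with, for each $H_A$, a probability distribution $p_{H_A}$ with positive values on $g(H_A)=\{i : H_A\in\mathcal{A}_i\}$; Alice broadcasts an index $i$ chosen according to $p_{H_A}$. It is equitable if there is $\gamma$ with $|g(H_A)|=\gamma$ for all $H_A$ and every $p_{H_A}$ uniform. For $H\subseteq X$, $\mathcal{P}(H,i)=\{H_A\in\mathcal{A}_i : H_A\cap H=\emptyset\}$. Informative for Bob: $|\mathcal{P}(H_B,i)|\le 1$ for every $b$-subset $H_B$ and every $i$. Perfectly $1$-secure against Cathy: for every $i$, every $c$-subset $H_C$ with $\mathcal{P}(H_C,i)\neq\emptyset$ and every $x\in X\setminus H_C$, $\Pr[x\in H_A\mid i,H_C]=a/(a+b)$, probability over the deal and Alice's choice. For $x\in X$, the neighborhood of $x$ with respect to $\mathcal{A}_i$ is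 $N(x)=\big(\bigcup\{H_A\in\mathcal{A}_i : x\in H_A\}\big)\setminus\{x\}$. -}

module Defs where

open import Data.Bool using (Bool; true; false; _∧_; not; if_then_else_)
open import Data.Nat as ℕ using (ℕ; zero; suc; _≡ᵇ_)
open import Data.Fin using (Fin)
open import Data.Fin.Subset using (Subset; ∣_∣; _∩_; _∪_; ⋃; ⁅_⁆; _─_; ∁; _∈_; _∉_)
open import Data.Vec using (Vec; []; _∷_; lookup)
open import Data.List using (List; []; _∷_; [_]; map; _++_; filterᵇ; foldr; allFin; length; concatMap)
open import Data.Integer using (+_)
open import Data.Rational using (ℚ; 0ℚ; 1ℚ; _+_; _*_; _/_; 1/_; _≟_; ≢-nonZero; _<_)
open import Data.Product using (∃; _×_)
open import Relation.Binary.PropositionalEquality using (_≡_)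
open import Relation.Nullary using (yes; no; does)

allSubsets : (n : ℕ) → List (Subset n)
allSubsets zero = [ [] ]
allSubsets (suc n) = map (true ∷_) (allSubsets n) ++ map (false ∷_) (allSubsets n)

_∈ᵇ_ : ∀ {n} → Fin n → Subset n → Bool
x ∈ᵇ H = lookup H x

disjointᵇ : ∀ {n} → Subset n → Subset n → Bool
disjointᵇ H K = ∣ H ∩ K ∣ ≡ᵇ 0

sizeᵇ : ∀ {n} → ℕ → Subset n → Bool
sizeᵇ k H = ∣ H ∣ ≡ᵇ k

sumℚ : List ℚ → ℚ
sumℚ = foldr _+_ 0ℚ

-- Rational p/q (with the convention p/0 = 0, irrelevant here since q > 0 where used)
frac : ℕ → ℕ → ℚ
frac p zero = 0ℚ
frac p (suc q) = + p / suc q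

-- A (general) strategy for Alice with hands of size a over the card set Fin n:
-- announcements 𝒜_0 … 𝒜_{m-1} (each a set of a-subsets, given by its
-- characteristic function), covering all a-subsets, and for each a-subset H
-- a probability distribution p H on the indices, positive exactly on g(H).
record Strategy (n a : ℕ) : Set where
  field
    m         : ℕ
    ann       : Fin m → Subset n → Bool
    ann-hands : ∀ i H → ann i H ≡ true → ∣ H ∣ ≡ a
    covers    : ∀ H → ∣ H ∣ ≡ a → ∃ λ i → ann i H ≡ true
    p         : Subset n → Fin m → ℚ
    p-pos     : ∀ H i → ∣ H ∣ ≡ a → ann i H ≡ true → 0ℚ < p H i
    p-zero    : ∀ H i → ∣ H ∣ ≡ a → ann i H ≡ false → p H i ≡ 0ℚ
    p-sum     : ∀ H → ∣ H ∣ ≡ a → sumℚ (map (p H) (allFin m)) ≡ 1ℚ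

module _ {n a : ℕ} (S : Strategy n a) where
  open Strategy S

  g : Subset n → List (Fin m)
  g H = filterᵇ (λ i → ann i H) (allFin m)

  Equitable : Set
  Equitable = ∃ λ γ → ∀ H → ∣ H ∣ ≡ a →
      (length (g H) ≡ γ)
    × (∀ i j → ann i H ≡ true → ann j H ≡ true → p H i ≡ p H j)

  -- Informative for Bob: |𝒫(H_B,i)| ≤ 1 for every b-subset H_B and every i.
  Informative : (b : ℕ) → Set
  Informative b = ∀ (i : Fin m) (HB : Subset n) → ∣ HB ∣ ≡ b →
    ∀ H H' → ann i H ≡ true → disjointᵇ H HB ≡ true →
             ann i H' ≡ true → disjointᵇ H' HB ≡ true → H ≡ H'

  module _ (b c : ℕ) where
    -- H_A and H_C come from an (a,b,c)-deal (H_B is the complement of H_A ∪ H_C)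
    validDealᵇ : Subset n → Subset n → Bool
    validDealᵇ HA HC = sizeᵇ a HA ∧ sizeᵇ c HC ∧ disjointᵇ HA HC ∧ sizeᵇ b (∁ (HA ∪ HC))

    numDeals : ℕ
    numDeals = length (concatMap (λ HA → filterᵇ (λ HC → validDealᵇ HA HC) (allSubsets n)) (allSubsets n))

    dealProb : Subset n → Subset n → ℚ
    dealProb HA HC = if validDealᵇ HA HC then frac 1 numDeals else 0ℚ

    -- Pr[ E(H_A) and Alice announces i and Cathy holds HC ]
    -- (probability over the deal and Alice's choice of announcement)
    Pr : (Subset n → Bool) → Fin m → Subset n → ℚ
    Pr E i HC = sumℚ (map (λ HA → if E HA then dealProb HA HC * p HA i else 0ℚ) (allSubsets n))

    -- Pr[ E(H_A) | i, H_C ]  (set to 0 when the conditioning event is null)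
    condProb : (Subset n → Bool) → Fin m → Subset n → ℚ
    condProb E i HC with Pr (λ _ → true) i HC ≟ 0ℚ
    ... | yes _ = 0ℚ
    ... | no ne = Pr E i HC * (1/_ (Pr (λ _ → true) i HC) {{≢-nonZero ne}})

    PerfectlySecure : Set
    PerfectlySecure = ∀ (i : Fin m) (HC : Subset n) → ∣ HC ∣ ≡ c →
      (∃ λ HA → ann i HA ≡ true × disjointᵇ HA HC ≡ true) →
      ∀ (x : Fin n) → x ∉ HC →
      condProb (λ HA → x ∈ᵇ HA) i HC ≡ frac a (a ℕ.+ b)

  N : Fin m → Fin n → Subset n
  N i x = ⋃ (filterᵇ (λ H → ann i H ∧ (x ∈ᵇ H)) (allSubsets n)) ─ ⁅ x ⁆

-- Fix the announcement 𝒜 = 𝒜ᵢ. Bob can always decode, so two distinct hands of 𝒜 share at most one card: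
-- two 3-sets sharing two cards cover only four cards, and Bob may hold exactly the other n − 4.
-- Alice's choice is uniform on 𝒜 and Cathy holds a single card z, so security says that the number of hands of 𝒜
-- through x avoiding z is the same for every x ≠ z. With r(x) = degree x hands through x and
-- λ(x, z) = pairDegree x z hands through x and z, this reads r(x) − λ(x, z) = r(y) − λ(y, z) for all z ∉ {x, y};
-- it also forces every card to be avoided and covered by some hand. If w were a neighbour of x but not of y,
-- then r(x) = r(y) + 1, whereas a third card s of a hand through y gives r(x) − r(y) = λ(x, s) − λ(y, s) ≤ 0.

module Submission where

open import Data.Bool using (Bool; true; false; _∧_; not; T?; if_then_else_)
import Data.Bool as Bool
open import Data.Bool.Properties using (T-≡)
open import Data.Empty using (⊥-elim)
open import Data.Fin using (Fin; zero; suc)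
open import Data.Fin.Subset
open import Data.Fin.Subset.Properties
open import Data.List using (List; []; _∷_; length; filterᵇ; map; allFin)
open import Data.List.Membership.Propositional using () renaming (_∈_ to _∈ₗ_)
open import Data.List.Membership.Propositional.Properties
  using (∈-map⁺; ∈-map⁻; ∈-++⁺ˡ; ∈-++⁺ʳ; ∈-filter⁺; ∈-filter⁻)
open import Data.List.Relation.Binary.Disjoint.Propositional using (Disjoint)
open import Data.List.Relation.Unary.All using ([]; _∷_)
open import Data.List.Relation.Unary.All.Properties using (all-filter)
open import Data.List.Relation.Unary.AllPairs using ([]; _∷_)
open import Data.List.Relation.Unary.Any using () renaming (here to hereₗ; there to thereₗ)
open import Data.List.Relation.Unary.Unique.Propositional using (Unique)
import Data.List.Relation.Unary.Unique.Propositional.Properties as Unique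
open import Data.Nat using (ℕ; zero; suc; _+_; _∸_; _≤_; _<_; _≡ᵇ_; z≤n; s≤s)
open import Data.Nat.Properties
open import Data.Product using (∃; _×_; _,_; proj₁; proj₂)
open import Data.Rational using (ℚ; 0ℚ; 1ℚ)
import Data.Rational as ℚ
import Data.Rational.Properties as ℚ
open import Algebra.Properties.Group ℚ.+-0-group using () renaming (∙-cancelˡ to +-cancelˡ)
open import Data.Sum using (inj₁; inj₂)
open import Data.Vec using ([]; _∷_; here; there)
open import Data.Vec.Properties using (lookup⇒[]=; []=⇒lookup; ∷-injectiveʳ; ≡-dec)
open import Function using (_∘_)
open import Function.Bundles using (Equivalence)
open import Relation.Binary.PropositionalEquality
open import Relation.Nullary using (yes; no; contradiction)
open import Relation.Nullary.Decidable using (_×-dec_; ¬?; decidable-stable)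

open import Defs

private
  variable
    n : ℕ

≡ᵇ-true : ∀ {m k} → m ≡ k → (m ≡ᵇ k) ≡ true
≡ᵇ-true {m} {k} m≡k = Equivalence.to T-≡ (≡⇒≡ᵇ m k m≡k)

≡ᵇ-false : ∀ {m k} → m ≢ k → (m ≡ᵇ k) ≡ false
≡ᵇ-false {m} {k} m≢k with m ≡ᵇ k in eq
... | true = ⊥-elim (m≢k (≡ᵇ⇒≡ m k (Equivalence.from T-≡ eq)))
... | false = refl

∧≡true⁻ : ∀ {b c} → b ∧ c ≡ true → b ≡ true × c ≡ true
∧≡true⁻ {true} {true} _ = refl , refl

-- Subsets of Fin n

x∈p⇒0<∣p∣ : ∀ {x} {p : Subset n} → x ∈ p → 0 < ∣ p ∣
x∈p⇒0<∣p∣ x∈p = ≤-trans (s≤s z≤n) (x∈p⇒∣p-x∣<∣p∣ x∈p)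

x,y∈p⇒1<∣p∣ : ∀ {x y} {p : Subset n} → x ∈ p → y ∈ p → x ≢ y → 1 < ∣ p ∣
x,y∈p⇒1<∣p∣ x∈p y∈p x≢y = ≤-trans (s≤s (x∈p⇒0<∣p∣ (x∈p∧x≢y⇒x∈p-y y∈p (x≢y ∘ sym)))) (x∈p⇒∣p-x∣<∣p∣ x∈p)

x∈p─q⇒x∉q : ∀ {x} (p q : Subset n) → x ∈ p ─ q → x ∉ q
x∈p─q⇒x∉q (s ∷ p) (outside ∷ q) (there x∈p─q) (there x∈q) = x∈p─q⇒x∉q p q x∈p─q x∈q
x∈p─q⇒x∉q (s ∷ p) (inside ∷ q) (there x∈p─q) (there x∈q) = x∈p─q⇒x∉q p q x∈p─q x∈q

∣p∪q∣+∣p∩q∣≡∣p∣+∣q∣ : ∀ (p q : Subset n) → ∣ p ∪ q ∣ + ∣ p ∩ q ∣ ≡ ∣ p ∣ + ∣ q ∣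
∣p∪q∣+∣p∩q∣≡∣p∣+∣q∣ [] [] = refl
∣p∪q∣+∣p∩q∣≡∣p∣+∣q∣ (outside ∷ p) (outside ∷ q) = ∣p∪q∣+∣p∩q∣≡∣p∣+∣q∣ p q
∣p∪q∣+∣p∩q∣≡∣p∣+∣q∣ (inside ∷ p) (outside ∷ q) = cong suc (∣p∪q∣+∣p∩q∣≡∣p∣+∣q∣ p q)
∣p∪q∣+∣p∩q∣≡∣p∣+∣q∣ (outside ∷ p) (inside ∷ q) = begin
  suc (∣ p ∪ q ∣ + ∣ p ∩ q ∣) ≡⟨ cong suc (∣p∪q∣+∣p∩q∣≡∣p∣+∣q∣ p q) ⟩
  suc (∣ p ∣ + ∣ q ∣)         ≡⟨ +-suc ∣ p ∣ ∣ q ∣ ⟨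
  ∣ p ∣ + suc ∣ q ∣           ∎
  where open ≡-Reasoning
∣p∪q∣+∣p∩q∣≡∣p∣+∣q∣ (inside ∷ p) (inside ∷ q) = begin
  suc (∣ p ∪ q ∣ + suc ∣ p ∩ q ∣) ≡⟨ cong suc (+-suc ∣ p ∪ q ∣ ∣ p ∩ q ∣) ⟩
  suc (suc (∣ p ∪ q ∣ + ∣ p ∩ q ∣)) ≡⟨ cong (2 +_) (∣p∪q∣+∣p∩q∣≡∣p∣+∣q∣ p q) ⟩
  suc (suc (∣ p ∣ + ∣ q ∣))       ≡⟨ cong suc (+-suc ∣ p ∣ ∣ q ∣) ⟨
  suc (∣ p ∣ + suc ∣ q ∣)         ∎
  where open ≡-Reasoning

∣p∪q∣≤∣p∣+∣q∣ : ∀ (p q : Subset n) → ∣ p ∪ q ∣ ≤ ∣ p ∣ + ∣ q ∣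
∣p∪q∣≤∣p∣+∣q∣ p q = ≤-trans (m≤m+n ∣ p ∪ q ∣ ∣ p ∩ q ∣) (≤-reflexive (∣p∪q∣+∣p∩q∣≡∣p∣+∣q∣ p q))

p⊆q⇒∣q∣≤∣p∣⇒p≡q : ∀ {p q : Subset n} → p ⊆ q → ∣ q ∣ ≤ ∣ p ∣ → p ≡ q
p⊆q⇒∣q∣≤∣p∣⇒p≡q {p = []} {[]} _ _ = refl
p⊆q⇒∣q∣≤∣p∣⇒p≡q {p = inside ∷ p} {inside ∷ q} p⊆q (s≤s ∣q∣≤∣p∣) =
  cong (inside ∷_) (p⊆q⇒∣q∣≤∣p∣⇒p≡q (drop-∷-⊆ p⊆q) ∣q∣≤∣p∣)
p⊆q⇒∣q∣≤∣p∣⇒p≡q {p = outside ∷ p} {outside ∷ q} p⊆q ∣q∣≤∣p∣ =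
  cong (outside ∷_) (p⊆q⇒∣q∣≤∣p∣⇒p≡q (drop-∷-⊆ p⊆q) ∣q∣≤∣p∣)
p⊆q⇒∣q∣≤∣p∣⇒p≡q {p = inside ∷ p} {outside ∷ q} p⊆q _ with p⊆q here
... | ()
p⊆q⇒∣q∣≤∣p∣⇒p≡q {p = outside ∷ p} {inside ∷ q} p⊆q ∣q∣≤∣p∣ =
  ⊥-elim (<⇒≱ (s≤s (p⊆q⇒∣p∣≤∣q∣ (drop-∷-⊆ p⊆q))) ∣q∣≤∣p∣)

q⊈p⇒t∷q⊈s∷p : ∀ {s t} {p q : Subset n} → (∃ λ x → x ∈ q × x ∉ p) → ∃ λ x → x ∈ t ∷ q × x ∉ s ∷ p
q⊈p⇒t∷q⊈s∷p (x , x∈q , x∉p) = suc x , there x∈q , x∉p ∘ drop-there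

∣p∣<∣q∣⇒q⊈p : ∀ (p q : Subset n) → ∣ p ∣ < ∣ q ∣ → ∃ λ x → x ∈ q × x ∉ p
∣p∣<∣q∣⇒q⊈p (outside ∷ p) (inside ∷ q) _ = zero , here , λ ()
∣p∣<∣q∣⇒q⊈p (inside ∷ p) (inside ∷ q) (s≤s ∣p∣<∣q∣) = q⊈p⇒t∷q⊈s∷p (∣p∣<∣q∣⇒q⊈p p q ∣p∣<∣q∣)
∣p∣<∣q∣⇒q⊈p (outside ∷ p) (outside ∷ q) ∣p∣<∣q∣ = q⊈p⇒t∷q⊈s∷p (∣p∣<∣q∣⇒q⊈p p q ∣p∣<∣q∣)
∣p∣<∣q∣⇒q⊈p (inside ∷ p) (outside ∷ q) ∣p∣<∣q∣ =
  q⊈p⇒t∷q⊈s∷p (∣p∣<∣q∣⇒q⊈p p q (<-trans (n<1+n _) ∣p∣<∣q∣))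

2<∣p∣⇒∃-third : ∀ {p : Subset n} → 2 < ∣ p ∣ → ∀ x y → ∃ λ s → s ∈ p × s ≢ x × s ≢ y
2<∣p∣⇒∃-third {p = p} 2<∣p∣ x y =
  let s , s∈p , s∉⁅x⁆∪⁅y⁆ = ∣p∣<∣q∣⇒q⊈p (⁅ x ⁆ ∪ ⁅ y ⁆) p ∣⁅x⁆∪⁅y⁆∣<∣p∣
  in s , s∈p , s∉⁅x⁆∪⁅y⁆ ∘ x∈p∪q⁺ ∘ inj₁ ∘ Equivalence.from x∈⁅y⁆⇔x≡y
       , s∉⁅x⁆∪⁅y⁆ ∘ x∈p∪q⁺ ∘ inj₂ ∘ Equivalence.from x∈⁅y⁆⇔x≡y
  where
  ∣⁅x⁆∪⁅y⁆∣<∣p∣ : ∣ ⁅ x ⁆ ∪ ⁅ y ⁆ ∣ < ∣ p ∣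
  ∣⁅x⁆∪⁅y⁆∣<∣p∣ = ≤-<-trans (≤-trans (∣p∪q∣≤∣p∣+∣q∣ ⁅ x ⁆ ⁅ y ⁆)
                               (≤-reflexive (cong₂ _+_ (∣⁅x⁆∣≡1 x) (∣⁅x⁆∣≡1 y)))) 2<∣p∣

∈ᵇ⇒∈ : ∀ {x} {p : Subset n} → x ∈ᵇ p ≡ true → x ∈ p
∈ᵇ⇒∈ {x = x} {p} = lookup⇒[]= x p

∈⇒∈ᵇ : ∀ {x} {p : Subset n} → x ∈ p → x ∈ᵇ p ≡ true
∈⇒∈ᵇ = []=⇒lookup

∈ᵇ-false⇒∉ : ∀ {x} {p : Subset n} → x ∈ᵇ p ≡ false → x ∉ p
∈ᵇ-false⇒∉ x∉ᵇp x∈p = contradiction (trans (sym (∈⇒∈ᵇ x∈p)) x∉ᵇp) λ ()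

∉⇒∈ᵇ-false : ∀ {x} {p : Subset n} → x ∉ p → x ∈ᵇ p ≡ false
∉⇒∈ᵇ-false {x = x} {p} x∉p with x ∈ᵇ p in x∈ᵇp
... | true = contradiction (∈ᵇ⇒∈ x∈ᵇp) x∉p
... | false = refl

Empty⇒∣p∣≡0 : ∀ {p : Subset n} → Empty p → ∣ p ∣ ≡ 0
Empty⇒∣p∣≡0 {n} p-empty = trans (cong ∣_∣ (Empty-unique p-empty)) (∣⊥∣≡0 n)

x∉p⇒Empty[p∩⁅x⁆] : ∀ {x} (p : Subset n) → x ∉ p → Empty (p ∩ ⁅ x ⁆)
x∉p⇒Empty[p∩⁅x⁆] {x = x} p x∉p (y , y∈p∩⁅x⁆) =
  let y∈p , y∈⁅x⁆ = x∈p∩q⁻ p ⁅ x ⁆ y∈p∩⁅x⁆ in x∉p (subst (_∈ p) (x∈⁅y⁆⇒x≡y x y∈⁅x⁆) y∈p)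

x∉p⇒∣p∪⁅x⁆∣≡1+∣p∣ : ∀ {x} (p : Subset n) → x ∉ p → ∣ p ∪ ⁅ x ⁆ ∣ ≡ suc ∣ p ∣
x∉p⇒∣p∪⁅x⁆∣≡1+∣p∣ {x = x} p x∉p = begin
  ∣ p ∪ ⁅ x ⁆ ∣                    ≡⟨ +-identityʳ _ ⟨
  ∣ p ∪ ⁅ x ⁆ ∣ + 0                ≡⟨ cong (∣ p ∪ ⁅ x ⁆ ∣ +_) (Empty⇒∣p∣≡0 (x∉p⇒Empty[p∩⁅x⁆] p x∉p)) ⟨
  ∣ p ∪ ⁅ x ⁆ ∣ + ∣ p ∩ ⁅ x ⁆ ∣    ≡⟨ ∣p∪q∣+∣p∩q∣≡∣p∣+∣q∣ p ⁅ x ⁆ ⟩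
  ∣ p ∣ + ∣ ⁅ x ⁆ ∣                ≡⟨ cong (∣ p ∣ +_) (∣⁅x⁆∣≡1 x) ⟩
  ∣ p ∣ + 1                        ≡⟨ +-comm ∣ p ∣ 1 ⟩
  suc ∣ p ∣                        ∎
  where open ≡-Reasoning

distinct-sets-meeting : ∀ {k} {p q : Subset n} → ∣ p ∣ ≡ suc k → ∣ q ∣ ≡ suc k → p ≢ q →
                        k ≤ ∣ p ∩ q ∣ → ∣ p ∪ q ∣ ≡ suc (suc k)
distinct-sets-meeting {k = k} {p} {q} ∣p∣≡1+k ∣q∣≡1+k p≢q k≤∣p∩q∣ =
  +-cancelʳ-≡ k _ _ (begin
    ∣ p ∪ q ∣ + k            ≡⟨ cong (∣ p ∪ q ∣ +_) ∣p∩q∣≡k ⟨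
    ∣ p ∪ q ∣ + ∣ p ∩ q ∣    ≡⟨ ∣p∪q∣+∣p∩q∣≡∣p∣+∣q∣ p q ⟩
    ∣ p ∣ + ∣ q ∣            ≡⟨ cong₂ _+_ ∣p∣≡1+k ∣q∣≡1+k ⟩
    suc k + suc k            ≡⟨ cong suc (+-suc k k) ⟩
    suc (suc k) + k          ∎)
  where
  open ≡-Reasoning
  ∣p∩q∣≤k : ∣ p ∩ q ∣ ≤ k
  ∣p∩q∣≤k with ∣ p ∩ q ∣ ≤? k
  ... | yes ∣p∩q∣≤k = ∣p∩q∣≤k
  ... | no ∣p∩q∣≰k = contradiction (trans (sym (p∩q≡ ∣p∣≡1+k (p∩q⊆p p q))) (p∩q≡ ∣q∣≡1+k (p∩q⊆q p q))) p≢q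
    where
    p∩q≡ : ∀ {r} → ∣ r ∣ ≡ suc k → p ∩ q ⊆ r → p ∩ q ≡ r
    p∩q≡ ∣r∣≡1+k p∩q⊆r = p⊆q⇒∣q∣≤∣p∣⇒p≡q p∩q⊆r (subst (_≤ ∣ p ∩ q ∣) (sym ∣r∣≡1+k) (≰⇒> ∣p∩q∣≰k))
  ∣p∩q∣≡k : ∣ p ∩ q ∣ ≡ k
  ∣p∩q∣≡k = ≤-antisym ∣p∩q∣≤k k≤∣p∩q∣

Empty⇒disjointᵇ : ∀ {p q : Subset n} → Empty (p ∩ q) → disjointᵇ p q ≡ true
Empty⇒disjointᵇ p∩q-empty = cong (_≡ᵇ 0) (Empty⇒∣p∣≡0 p∩q-empty)

x∈p∩q⇒disjointᵇ-false : ∀ {x} {p q : Subset n} → x ∈ p → x ∈ q → disjointᵇ p q ≡ false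
x∈p∩q⇒disjointᵇ-false x∈p x∈q = ≡ᵇ-false (>⇒≢ (x∈p⇒0<∣p∣ (x∈p∩q⁺ (x∈p , x∈q))))

disjointᵇ-⁅⁆ : ∀ (p : Subset n) z → disjointᵇ p ⁅ z ⁆ ≡ not (z ∈ᵇ p)
disjointᵇ-⁅⁆ p z with z ∈ᵇ p in z∈ᵇp
... | true = x∈p∩q⇒disjointᵇ-false (∈ᵇ⇒∈ {p = p} z∈ᵇp) (x∈⁅x⁆ z)
... | false = Empty⇒disjointᵇ (x∉p⇒Empty[p∩⁅x⁆] p (∈ᵇ-false⇒∉ z∈ᵇp))

p⊆q⇒disjointᵇ-∁q : ∀ {p q : Subset n} → p ⊆ q → disjointᵇ p (∁ q) ≡ true
p⊆q⇒disjointᵇ-∁q {p = p} {q} p⊆q = Empty⇒disjointᵇ λ where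
  (x , x∈p∩∁q) → let x∈p , x∈∁q = x∈p∩q⁻ p (∁ q) x∈p∩∁q in x∈∁p⇒x∉p x∈∁q (p⊆q x∈p)

∈-allSubsets : ∀ (p : Subset n) → p ∈ₗ allSubsets n
∈-allSubsets [] = hereₗ refl
∈-allSubsets {suc n} (inside ∷ p) = ∈-++⁺ˡ (∈-map⁺ (inside ∷_) (∈-allSubsets p))
∈-allSubsets {suc n} (outside ∷ p) =
  ∈-++⁺ʳ (map (inside ∷_) (allSubsets n)) (∈-map⁺ (outside ∷_) (∈-allSubsets p))

allSubsets-unique : ∀ n → Unique (allSubsets n)
allSubsets-unique zero = [] ∷ []
allSubsets-unique (suc n) = Unique.++⁺ (∷-unique inside) (∷-unique outside) heads-differ
  where
  ∷-unique : ∀ s → Unique (map (s ∷_) (allSubsets n))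
  ∷-unique s = Unique.map⁺ ∷-injectiveʳ (allSubsets-unique n)
  heads-differ : Disjoint (map (inside ∷_) (allSubsets n)) (map (outside ∷_) (allSubsets n))
  heads-differ (v∈ins , v∈outs) with ∈-map⁻ (inside ∷_) v∈ins | ∈-map⁻ (outside ∷_) v∈outs
  ... | _ , _ , refl | _ , _ , ()

x∈⋃⁺ : ∀ {x} {p : Subset n} {ps} → p ∈ₗ ps → x ∈ p → x ∈ ⋃ ps
x∈⋃⁺ (hereₗ refl) x∈p = x∈p∪q⁺ (inj₁ x∈p)
x∈⋃⁺ (thereₗ p∈ps) x∈p = x∈p∪q⁺ (inj₂ (x∈⋃⁺ p∈ps x∈p))

x∈⋃⁻ : ∀ {x} (ps : List (Subset n)) → x ∈ ⋃ ps → ∃ λ p → p ∈ₗ ps × x ∈ p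
x∈⋃⁻ [] x∈⊥ = ⊥-elim (∉⊥ x∈⊥)
x∈⋃⁻ (p ∷ ps) x∈⋃ with x∈p∪q⁻ p (⋃ ps) x∈⋃
... | inj₁ x∈p = p , hereₗ refl , x∈p
... | inj₂ x∈⋃ps = let q , q∈ps , x∈q = x∈⋃⁻ ps x∈⋃ps in q , thereₗ q∈ps , x∈q

-- Counting

module _ {A : Set} where

  count : (A → Bool) → List A → ℕ
  count P xs = length (filterᵇ P xs)

  count-split : ∀ (P Q : A → Bool) xs →
                count P xs ≡ count (λ x → P x ∧ Q x) xs + count (λ x → P x ∧ not (Q x)) xs
  count-split P Q [] = refl
  count-split P Q (x ∷ xs) with P x | Q x
  ... | false | _ = count-split P Q xs
  ... | true | true = cong suc (count-split P Q xs)
  ... | true | false = trans (cong suc (count-split P Q xs)) (sym (+-suc _ _))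

  count-pos : ∀ (P : A → Bool) {x xs} → x ∈ₗ xs → P x ≡ true → 0 < count P xs
  count-pos P {xs = y ∷ xs} (hereₗ refl) Px with P y
  count-pos P {xs = y ∷ xs} (hereₗ refl) refl | .true = s≤s z≤n
  count-pos P {xs = y ∷ xs} (thereₗ x∈xs) Px with P y
  ... | true = s≤s z≤n
  ... | false = count-pos P x∈xs Px

  count-witness : ∀ (P : A → Bool) xs → 0 < count P xs → ∃ λ x → P x ≡ true
  count-witness P xs 0<count with filterᵇ P xs | all-filter (T? ∘ P) xs
  ... | x ∷ _ | Px ∷ _ = x , Equivalence.to T-≡ Px

  count-mono : ∀ {P Q : A → Bool} → (∀ x → P x ≡ true → Q x ≡ true) → ∀ xs → count P xs ≤ count Q xs
  count-mono {P} {Q} P⇒Q [] = z≤n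
  count-mono {P} {Q} P⇒Q (x ∷ xs) with P x in Px | Q x in Qx
  ... | false | false = count-mono P⇒Q xs
  ... | false | true = m≤n⇒m≤1+n (count-mono P⇒Q xs)
  ... | true | true = s≤s (count-mono P⇒Q xs)
  ... | true | false = contradiction (trans (sym Qx) (P⇒Q x Px)) λ ()

  count-mono-< : ∀ {P Q : A → Bool} → (∀ x → P x ≡ true → Q x ≡ true) →
                 ∀ {x xs} → x ∈ₗ xs → P x ≡ false → Q x ≡ true → count P xs < count Q xs
  count-mono-< {P} {Q} P⇒Q {xs = y ∷ xs} (hereₗ refl) Px Qx rewrite Px | Qx = s≤s (count-mono P⇒Q xs)
  count-mono-< {P} {Q} P⇒Q {xs = y ∷ xs} (thereₗ x∈xs) Px Qx with P y in Py | Q y in Qy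
  ... | false | false = count-mono-< P⇒Q x∈xs Px Qx
  ... | false | true = m≤n⇒m≤1+n (count-mono-< P⇒Q x∈xs Px Qx)
  ... | true | true = s≤s (count-mono-< P⇒Q x∈xs Px Qx)
  ... | true | false = contradiction (trans (sym Qy) (P⇒Q y Py)) λ ()

  count≤1 : ∀ (P : A → Bool) {xs} → Unique xs →
            (∀ {x y} → P x ≡ true → P y ≡ true → x ≡ y) → count P xs ≤ 1
  count≤1 P {xs} xs-unique P-unique
    with filterᵇ P xs | Unique.filter⁺ (T? ∘ P) xs-unique | all-filter (T? ∘ P) xs
  ... | [] | _ | _ = z≤n
  ... | _ ∷ [] | _ | _ = s≤s z≤n
  ... | _ ∷ _ ∷ _ | (x≢y ∷ _) ∷ _ | Px ∷ Py ∷ _ =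
    contradiction (P-unique (Equivalence.to T-≡ Px) (Equivalence.to T-≡ Py)) x≢y

-- Rationals

fromℕ : ℕ → ℚ
fromℕ zero = 0ℚ
fromℕ (suc k) = 1ℚ ℚ.+ fromℕ k

fromℕ-nonNegative : ∀ k → ℚ.NonNegative (fromℕ k)
fromℕ-nonNegative zero = _
fromℕ-nonNegative (suc k) = ℚ.nonNeg+nonNeg⇒nonNeg 1ℚ (fromℕ k) {{fromℕ-nonNegative k}}

fromℕ-suc≢0 : ∀ k → fromℕ (suc k) ≢ 0ℚ
fromℕ-suc≢0 k = ≢-sym (ℚ.<⇒≢ (ℚ.positive⁻¹ _ {{ℚ.pos+nonNeg⇒pos 1ℚ (fromℕ k) {{fromℕ-nonNegative k}}}}))

fromℕ-injective : ∀ {k l} → fromℕ k ≡ fromℕ l → k ≡ l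
fromℕ-injective {zero} {zero} _ = refl
fromℕ-injective {zero} {suc l} eq = contradiction (sym eq) (fromℕ-suc≢0 l)
fromℕ-injective {suc k} {zero} eq = contradiction eq (fromℕ-suc≢0 k)
fromℕ-injective {suc k} {suc l} eq = cong suc (fromℕ-injective (+-cancelˡ 1ℚ _ _ eq))

frac-suc≢0 : ∀ k l → frac (suc k) (suc l) ≢ 0ℚ
frac-suc≢0 k l = ≢-sym (ℚ.<⇒≢ (ℚ.positive⁻¹ _ {{ℚ.normalize-pos (suc k) (suc l)}}))

*-cancelʳ-≢0 : ∀ {p q r : ℚ} → r ≢ 0ℚ → p ℚ.* r ≡ q ℚ.* r → p ≡ q
*-cancelʳ-≢0 {p} {q} {r} r≢0 pr≡qr = begin
  p                   ≡⟨ ℚ.*-identityʳ p ⟨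
  p ℚ.* 1ℚ            ≡⟨ cong (p ℚ.*_) (ℚ.*-inverseʳ r) ⟨
  p ℚ.* (r ℚ.* 1/r)   ≡⟨ ℚ.*-assoc p r 1/r ⟨
  (p ℚ.* r) ℚ.* 1/r   ≡⟨ cong (ℚ._* 1/r) pr≡qr ⟩
  (q ℚ.* r) ℚ.* 1/r   ≡⟨ ℚ.*-assoc q r 1/r ⟩
  q ℚ.* (r ℚ.* 1/r)   ≡⟨ cong (q ℚ.*_) (ℚ.*-inverseʳ r) ⟩
  q ℚ.* 1ℚ            ≡⟨ ℚ.*-identityʳ q ⟩
  q                   ∎
  where
  open ≡-Reasoning
  instance _ = ℚ.≢-nonZero r≢0
  1/r = ℚ.1/ r

sumℚ-if : ∀ {A : Set} (f : A → ℚ) (Q : A → Bool) (K : ℚ) →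
          (∀ x → f x ≡ (if Q x then K else 0ℚ)) → ∀ xs → sumℚ (map f xs) ≡ fromℕ (count Q xs) ℚ.* K
sumℚ-if f Q K f≡ [] = sym (ℚ.*-zeroˡ K)
sumℚ-if f Q K f≡ (x ∷ xs) rewrite f≡ x with Q x
... | true = begin
  K ℚ.+ sumℚ (map f xs)                  ≡⟨ cong₂ ℚ._+_ (sym (ℚ.*-identityˡ K)) (sumℚ-if f Q K f≡ xs) ⟩
  1ℚ ℚ.* K ℚ.+ fromℕ (count Q xs) ℚ.* K  ≡⟨ ℚ.*-distribʳ-+ K 1ℚ (fromℕ (count Q xs)) ⟨
  (1ℚ ℚ.+ fromℕ (count Q xs)) ℚ.* K       ∎
  where open ≡-Reasoning
... | false = trans (ℚ.+-identityˡ _) (sumℚ-if f Q K f≡ xs)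

-- Alice's hand given Cathy's single card

module _ {n a} (S : Strategy n a) where
  open Strategy S

  Pr≡condProb*Pr : ∀ b c E i HC {q} → condProb S b c E i HC ≡ q → q ≢ 0ℚ →
                   Pr S b c (λ _ → true) i HC ≢ 0ℚ × Pr S b c E i HC ≡ q ℚ.* Pr S b c (λ _ → true) i HC
  Pr≡condProb*Pr b c E i HC {q} condProb≡q q≢0 with Pr S b c (λ _ → true) i HC ℚ.≟ 0ℚ
  ... | yes _ = contradiction (sym condProb≡q) q≢0
  ... | no total≢0 = total≢0 , (begin
    PrE                               ≡⟨ ℚ.*-identityʳ PrE ⟨
    PrE ℚ.* 1ℚ                        ≡⟨ cong (PrE ℚ.*_) (ℚ.*-inverseˡ total) ⟨
    PrE ℚ.* (ℚ.1/ total ℚ.* total)    ≡⟨ ℚ.*-assoc PrE _ total ⟨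
    PrE ℚ.* ℚ.1/ total ℚ.* total      ≡⟨ cong (ℚ._* total) condProb≡q ⟩
    q ℚ.* total                       ∎)
    where
    open ≡-Reasoning
    instance _ = ℚ.≢-nonZero total≢0
    total = Pr S b c (λ _ → true) i HC
    PrE = Pr S b c E i HC

  validDealᵇ-⁅⁆ : ∀ H z → ∣ H ∣ ≡ a → validDealᵇ S (n ∸ suc a) 1 H ⁅ z ⁆ ≡ not (z ∈ᵇ H)
  validDealᵇ-⁅⁆ H z ∣H∣≡a
    rewrite ≡ᵇ-true ∣H∣≡a | ≡ᵇ-true (∣⁅x⁆∣≡1 z) | disjointᵇ-⁅⁆ H z with z ∈ᵇ H in z∈ᵇH
  ... | true = refl
  ... | false = ≡ᵇ-true (begin
    ∣ ∁ (H ∪ ⁅ z ⁆) ∣      ≡⟨ ∣∁p∣≡n∸∣p∣ (H ∪ ⁅ z ⁆) ⟩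
    n ∸ ∣ H ∪ ⁅ z ⁆ ∣      ≡⟨ cong (n ∸_) (x∉p⇒∣p∪⁅x⁆∣≡1+∣p∣ H (∈ᵇ-false⇒∉ z∈ᵇH)) ⟩
    n ∸ suc ∣ H ∣          ≡⟨ cong (λ k → n ∸ suc k) ∣H∣≡a ⟩
    n ∸ suc a              ∎)
    where open ≡-Reasoning

  module _ (i : Fin m) where

    avoidingᵇ : (Subset n → Bool) → Fin n → Subset n → Bool
    avoidingᵇ E z H = (E H ∧ ann i H) ∧ not (z ∈ᵇ H)

    countAvoiding : (Subset n → Bool) → Fin n → ℕ
    countAvoiding E z = count (avoidingᵇ E z) (allSubsets n)

    avoidingᵇ⁺ : ∀ {H x z} → ann i H ≡ true → x ∈ H → z ∉ H → avoidingᵇ (x ∈ᵇ_) z H ≡ true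
    avoidingᵇ⁺ H∈𝒜 x∈H z∉H = cong₂ _∧_ (cong₂ _∧_ (∈⇒∈ᵇ x∈H) H∈𝒜) (cong not (∉⇒∈ᵇ-false z∉H))

    avoidingᵇ⁻ : ∀ {H x z} → avoidingᵇ (x ∈ᵇ_) z H ≡ true → ann i H ≡ true × x ∈ H × z ∉ H
    avoidingᵇ⁻ {H} {x} {z} _ with x ∈ᵇ H in x∈ᵇH | ann i H | z ∈ᵇ H in z∈ᵇH
    ... | true | true | false = refl , ∈ᵇ⇒∈ x∈ᵇH , ∈ᵇ-false⇒∉ z∈ᵇH

    hand⇒0<countAvoiding : ∀ {H x z} → ann i H ≡ true → x ∈ H → z ∉ H → 0 < countAvoiding (x ∈ᵇ_) z
    hand⇒0<countAvoiding {H} H∈𝒜 x∈H z∉H = count-pos _ (∈-allSubsets H) (avoidingᵇ⁺ H∈𝒜 x∈H z∉H)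

    0<countAvoiding⇒hand : ∀ {x z} → 0 < countAvoiding (x ∈ᵇ_) z → ∃ λ H → ann i H ≡ true × x ∈ H × z ∉ H
    0<countAvoiding⇒hand {x} {z} 0<count =
      let H , h = count-witness (avoidingᵇ (x ∈ᵇ_) z) (allSubsets n) 0<count in H , avoidingᵇ⁻ h

    Equitable⇒p-uniform : Equitable S → ∀ {H H'} → ann i H ≡ true → ann i H' ≡ true → p H i ≡ p H' i
    Equitable⇒p-uniform (γ , equitable) {H} {H'} H∈𝒜 H'∈𝒜 =
      *-cancelʳ-≢0 γ≢0 (trans (ℚ.*-comm (p H i) (fromℕ γ))
                       (trans (γ*p≡1 H∈𝒜) (trans (sym (γ*p≡1 H'∈𝒜)) (ℚ.*-comm (fromℕ γ) (p H' i)))))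
      where
      γ*p≡1 : ∀ {H} → ann i H ≡ true → fromℕ γ ℚ.* p H i ≡ 1ℚ
      γ*p≡1 {H} H∈𝒜 = begin
        fromℕ γ ℚ.* p H i                                   ≡⟨ cong (λ k → fromℕ k ℚ.* p H i) ∣g[H]∣≡γ ⟨
        fromℕ (count (λ j → ann j H) (allFin m)) ℚ.* p H i  ≡⟨ sumℚ-if (p H) (λ j → ann j H) (p H i) p≡ (allFin m) ⟨
        sumℚ (map (p H) (allFin m))                         ≡⟨ p-sum H ∣H∣≡a ⟩
        1ℚ                                                  ∎
        where
        open ≡-Reasoning
        ∣H∣≡a = ann-hands i H H∈𝒜
        ∣g[H]∣≡γ = proj₁ (equitable H ∣H∣≡a)
        p≡ : ∀ j → p H j ≡ (if ann j H then p H i else 0ℚ)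
        p≡ j with ann j H in H∈𝒜ⱼ
        ... | true = proj₂ (equitable H ∣H∣≡a) j i H∈𝒜ⱼ H∈𝒜
        ... | false = p-zero H j ∣H∣≡a H∈𝒜ⱼ
      γ≢0 : fromℕ γ ≢ 0ℚ
      γ≢0 γ≡0 = contradiction (trans (sym (γ*p≡1 H∈𝒜)) (trans (cong (ℚ._* p H i) γ≡0) (ℚ.*-zeroˡ (p H i)))) λ ()

    module _ (equitable : Equitable S) {H₀} (H₀∈𝒜 : ann i H₀ ≡ true) where

      dealWeight : ℚ
      dealWeight = frac 1 (numDeals S (n ∸ suc a) 1) ℚ.* p H₀ i

      -- Only deals whose hand lies in 𝒜 and avoids z count, all with the same weight as p is uniform on 𝒜.
      dealProb*p : ∀ H z → dealProb S (n ∸ suc a) 1 H ⁅ z ⁆ ℚ.* p H i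
                           ≡ (if ann i H ∧ not (z ∈ᵇ H) then dealWeight else 0ℚ)
      dealProb*p H z with ann i H in H∈𝒜
      ... | true rewrite validDealᵇ-⁅⁆ H z (ann-hands i H H∈𝒜) with z ∈ᵇ H
      ...   | true = ℚ.*-zeroˡ (p H i)
      ...   | false = cong (frac 1 (numDeals S (n ∸ suc a) 1) ℚ.*_) (Equitable⇒p-uniform equitable H∈𝒜 H₀∈𝒜)
      dealProb*p H z | false with ∣ H ∣ ≟ a
      ...   | yes ∣H∣≡a = trans (cong (dealProb S (n ∸ suc a) 1 H ⁅ z ⁆ ℚ.*_) (p-zero H i ∣H∣≡a H∈𝒜))
                                (ℚ.*-zeroʳ (dealProb S (n ∸ suc a) 1 H ⁅ z ⁆))
      ...   | no ∣H∣≢a rewrite ≡ᵇ-false ∣H∣≢a = ℚ.*-zeroˡ (p H i)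

      Pr-⁅⁆ : ∀ E z → Pr S (n ∸ suc a) 1 E i ⁅ z ⁆ ≡ fromℕ (countAvoiding E z) ℚ.* dealWeight
      Pr-⁅⁆ E z = sumℚ-if _ _ dealWeight summand (allSubsets n)
        where
        summand : ∀ H → (if E H then dealProb S (n ∸ suc a) 1 H ⁅ z ⁆ ℚ.* p H i else 0ℚ)
                        ≡ (if avoidingᵇ E z H then dealWeight else 0ℚ)
        summand H with E H
        ... | true = dealProb*p H z
        ... | false = refl

-- Security gives Pr[x ∈ H_A, i, z] = ρ · Pr[i, z] for every x ≠ z, and Pr[i, z] ≠ 0 makes the deal weight nonzero.
countAvoiding-uniform : ∀ {n k} (S : Strategy n (suc k)) → Equitable S → PerfectlySecure S (n ∸ suc (suc k)) 1 →
                        ∀ i {H₀ z} → Strategy.ann S i H₀ ≡ true → z ∉ H₀ →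
                        ∀ {x y} → x ≢ z → y ≢ z → countAvoiding S i (x ∈ᵇ_) z ≡ countAvoiding S i (y ∈ᵇ_) z
countAvoiding-uniform {n} {k} S equitable secure i {H₀} {z} H₀∈𝒜 z∉H₀ {x} {y} x≢z y≢z =
  fromℕ-injective (*-cancelʳ-≢0 weight≢0 (begin
    fromℕ (countAvoiding S i (x ∈ᵇ_) z) ℚ.* weight  ≡⟨ Pr-⁅⁆ S i equitable H₀∈𝒜 (x ∈ᵇ_) z ⟨
    Pr S b 1 (x ∈ᵇ_) i ⁅ z ⁆                         ≡⟨ proj₂ (Pr-from-security x≢z) ⟩
    ρ ℚ.* total                                      ≡⟨ proj₂ (Pr-from-security y≢z) ⟨
    Pr S b 1 (y ∈ᵇ_) i ⁅ z ⁆                         ≡⟨ Pr-⁅⁆ S i equitable H₀∈𝒜 (y ∈ᵇ_) z ⟩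
    fromℕ (countAvoiding S i (y ∈ᵇ_) z) ℚ.* weight  ∎))
  where
  open ≡-Reasoning
  b = n ∸ suc (suc k)
  ρ = frac (suc k) (suc k + b)
  total = Pr S b 1 (λ _ → true) i ⁅ z ⁆
  weight = dealWeight S i equitable H₀∈𝒜
  Pr-from-security : ∀ {x} → x ≢ z → total ≢ 0ℚ × Pr S b 1 (x ∈ᵇ_) i ⁅ z ⁆ ≡ ρ ℚ.* total
  Pr-from-security {x} x≢z =
    Pr≡condProb*Pr S b 1 (x ∈ᵇ_) i ⁅ z ⁆
      (secure i ⁅ z ⁆ (∣⁅x⁆∣≡1 z) (H₀ , H₀∈𝒜 , trans (disjointᵇ-⁅⁆ H₀ z) (cong not (∉⇒∈ᵇ-false z∉H₀)))
              x (x≢y⇒x∉⁅y⁆ x≢z))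
      (frac-suc≢0 k (k + b))
  weight≢0 : weight ≢ 0ℚ
  weight≢0 weight≡0 = proj₁ (Pr-from-security x≢z) (begin
    total                      ≡⟨ Pr-⁅⁆ S i equitable H₀∈𝒜 (λ _ → true) z ⟩
    fromℕ avoiders ℚ.* weight  ≡⟨ cong (fromℕ avoiders ℚ.*_) weight≡0 ⟩
    fromℕ avoiders ℚ.* 0ℚ      ≡⟨ ℚ.*-zeroʳ (fromℕ avoiders) ⟩
    0ℚ                         ∎)
    where avoiders = countAvoiding S i (λ _ → true) z

-- Announcements of 3-card hands

module _ {n} (S : Strategy n 3) (i : Fin (Strategy.m S)) where
  open Strategy S

  degree : Fin n → ℕ
  degree x = count (λ H → x ∈ᵇ H ∧ ann i H) (allSubsets n)

  pairingᵇ : Fin n → Fin n → Subset n → Bool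
  pairingᵇ x z H = (x ∈ᵇ H ∧ ann i H) ∧ z ∈ᵇ H

  pairDegree : Fin n → Fin n → ℕ
  pairDegree x z = count (pairingᵇ x z) (allSubsets n)

  pairingᵇ⁻ : ∀ {H x z} → pairingᵇ x z H ≡ true → ann i H ≡ true × x ∈ H × z ∈ H
  pairingᵇ⁻ {H} {x} {z} _ with x ∈ᵇ H in x∈ᵇH | ann i H | z ∈ᵇ H in z∈ᵇH
  ... | true | true | true = refl , ∈ᵇ⇒∈ x∈ᵇH , ∈ᵇ⇒∈ z∈ᵇH

  hand⇒0<pairDegree : ∀ {H x z} → ann i H ≡ true → x ∈ H → z ∈ H → 0 < pairDegree x z
  hand⇒0<pairDegree {H} H∈𝒜 x∈H z∈H =
    count-pos _ (∈-allSubsets H) (cong₂ _∧_ (cong₂ _∧_ (∈⇒∈ᵇ x∈H) H∈𝒜) (∈⇒∈ᵇ z∈H))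

  0<pairDegree⇒hand : ∀ {x z} → 0 < pairDegree x z → ∃ λ H → ann i H ≡ true × x ∈ H × z ∈ H
  0<pairDegree⇒hand {x} {z} 0<count =
    let H , h = count-witness (pairingᵇ x z) (allSubsets n) 0<count in H , pairingᵇ⁻ h

  degree-split : ∀ x z → degree x ≡ pairDegree x z + countAvoiding S i (x ∈ᵇ_) z
  degree-split x z = count-split (λ H → x ∈ᵇ H ∧ ann i H) (z ∈ᵇ_) (allSubsets n)

  pairDegree≤1 : Informative S (n ∸ 4) → ∀ {x z} → x ≢ z → pairDegree x z ≤ 1
  pairDegree≤1 informative {x} {z} x≢z = count≤1 _ (allSubsets-unique n) same-hand
    where
    same-hand : ∀ {H H'} → pairingᵇ x z H ≡ true → pairingᵇ x z H' ≡ true → H ≡ H'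
    same-hand {H} {H'} H-pairs H'-pairs with ≡-dec Bool._≟_ H H'
    ... | yes H≡H' = H≡H'
    ... | no H≢H' = informative i (∁ (H ∪ H')) ∣∁[H∪H']∣≡n∸4
                      H H' H∈𝒜 (p⊆q⇒disjointᵇ-∁q {p = H} (p⊆p∪q H')) H'∈𝒜 (p⊆q⇒disjointᵇ-∁q (q⊆p∪q H H'))
      where
      H∈𝒜 = proj₁ (pairingᵇ⁻ H-pairs)
      H'∈𝒜 = proj₁ (pairingᵇ⁻ H'-pairs)
      x,z∈H∩H' : x ∈ H ∩ H' × z ∈ H ∩ H'
      x,z∈H∩H' = let _ , x∈H , z∈H = pairingᵇ⁻ H-pairs ; _ , x∈H' , z∈H' = pairingᵇ⁻ H'-pairs
                 in x∈p∩q⁺ (x∈H , x∈H') , x∈p∩q⁺ (z∈H , z∈H')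
      ∣∁[H∪H']∣≡n∸4 : ∣ ∁ (H ∪ H') ∣ ≡ n ∸ 4
      ∣∁[H∪H']∣≡n∸4 = trans (∣∁p∣≡n∸∣p∣ (H ∪ H')) (cong (n ∸_)
        (distinct-sets-meeting (ann-hands i H H∈𝒜) (ann-hands i H' H'∈𝒜) H≢H'
          (x,y∈p⇒1<∣p∣ (proj₁ x,z∈H∩H') (proj₂ x,z∈H∩H') x≢z)))

  module _ (4<n : 4 < n) (equitable : Equitable S) (secure : PerfectlySecure S (n ∸ 4) 1) where

    countAvoiding-uniform′ : ∀ {H z} → ann i H ≡ true → z ∉ H →
                             ∀ {x y} → x ≢ z → y ≢ z → countAvoiding S i (x ∈ᵇ_) z ≡ countAvoiding S i (y ∈ᵇ_) z
    countAvoiding-uniform′ = countAvoiding-uniform S equitable secure i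

    module _ {H₀} (H₀∈𝒜 : ann i H₀ ≡ true) where

      -- If every hand contained z, pick z₀ ∉ H₀ and a ∉ H₀ ∪ {z₀}: every hand through a avoiding z₀
      -- also passes through z, and H₀ passes through z but not a, so fewer hands avoiding z₀ contain a than z.
      every-card-avoided : ∀ z → ∃ λ H → ann i H ≡ true × z ∉ H
      every-card-avoided z with anySubset? (λ H → ann i H Bool.≟ true ×-dec ¬? (z ∈? H))
      ... | yes avoider = avoider
      ... | no no-avoider = contradiction (countAvoiding-uniform′ H₀∈𝒜 z₀∉H₀ a≢z₀ z≢z₀) (<⇒≢ fewer-avoid-a)
        where
        z∈every-hand : ∀ {H} → ann i H ≡ true → z ∈ H
        z∈every-hand {H} H∈𝒜 = decidable-stable (z ∈? H) (λ z∉H → no-avoider (H , H∈𝒜 , z∉H))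
        ∣H₀∣≡3 = ann-hands i H₀ H₀∈𝒜
        z₀∈ = ∣p∣<∣q∣⇒q⊈p H₀ ⊤ (subst₂ _<_ (sym ∣H₀∣≡3) (sym (∣⊤∣≡n n)) (<-trans (n<1+n 3) 4<n))
        z₀ = proj₁ z₀∈
        z₀∉H₀ = proj₂ (proj₂ z₀∈)
        a∈ = ∣p∣<∣q∣⇒q⊈p (H₀ ∪ ⁅ z₀ ⁆) ⊤
               (subst₂ _<_ (sym (trans (x∉p⇒∣p∪⁅x⁆∣≡1+∣p∣ H₀ z₀∉H₀) (cong suc ∣H₀∣≡3))) (sym (∣⊤∣≡n n)) 4<n)
        a = proj₁ a∈
        a∉H₀ : a ∉ H₀
        a∉H₀ = proj₂ (proj₂ a∈) ∘ x∈p∪q⁺ ∘ inj₁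
        a≢z₀ : a ≢ z₀
        a≢z₀ = x∉⁅y⁆⇒x≢y (proj₂ (proj₂ a∈) ∘ x∈p∪q⁺ ∘ inj₂)
        z≢z₀ : z ≢ z₀
        z≢z₀ z≡z₀ = z₀∉H₀ (subst (_∈ H₀) z≡z₀ (z∈every-hand H₀∈𝒜))
        fewer-avoid-a : countAvoiding S i (a ∈ᵇ_) z₀ < countAvoiding S i (z ∈ᵇ_) z₀
        fewer-avoid-a = count-mono-< a⇒z (∈-allSubsets H₀)
          (cong (λ b → (b ∧ ann i H₀) ∧ not (z₀ ∈ᵇ H₀)) (∉⇒∈ᵇ-false a∉H₀))
          (avoidingᵇ⁺ S i H₀∈𝒜 (z∈every-hand H₀∈𝒜) z₀∉H₀)
          where
          a⇒z : ∀ H → avoidingᵇ S i (a ∈ᵇ_) z₀ H ≡ true → avoidingᵇ S i (z ∈ᵇ_) z₀ H ≡ true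
          a⇒z H h = let H∈𝒜 , _ , z₀∉H = avoidingᵇ⁻ S i {H} h in avoidingᵇ⁺ S i H∈𝒜 (z∈every-hand H∈𝒜) z₀∉H

      every-card-covered : ∀ {x y} → x ≢ y → ∃ λ H → ann i H ≡ true × y ∈ H × x ∉ H
      every-card-covered {x} {y} x≢y = 0<countAvoiding⇒hand S i
        (subst (0 <_) (countAvoiding-uniform′ H₁∈𝒜 x∉H₁ u≢x (≢-sym x≢y)) (hand⇒0<countAvoiding S i H₁∈𝒜 u∈H₁ x∉H₁))
        where
        avoider = every-card-avoided x
        H₁ = proj₁ avoider
        H₁∈𝒜 = proj₁ (proj₂ avoider)
        x∉H₁ = proj₂ (proj₂ avoider)
        u∈ = ∣p∣<∣q∣⇒q⊈p ⊥ H₁ (subst₂ _<_ (sym (∣⊥∣≡0 n)) (sym (ann-hands i H₁ H₁∈𝒜)) (s≤s z≤n))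
        u = proj₁ u∈
        u∈H₁ = proj₁ (proj₂ u∈)
        u≢x : u ≢ x
        u≢x u≡x = x∉H₁ (subst (_∈ H₁) u≡x u∈H₁)

      balance : ∀ {x y z} → z ≢ x → z ≢ y → degree x + pairDegree y z ≡ degree y + pairDegree x z
      balance {x} {y} {z} z≢x z≢y = begin
        degree x + Λyz           ≡⟨ cong (_+ Λyz) (degree-split x z) ⟩
        (Λxz + avoid x) + Λyz    ≡⟨ cong (λ c → (Λxz + c) + Λyz) avoid-x≡avoid-y ⟩
        (Λxz + avoid y) + Λyz    ≡⟨ +-comm (Λxz + avoid y) Λyz ⟩
        Λyz + (Λxz + avoid y)    ≡⟨ cong (Λyz +_) (+-comm Λxz (avoid y)) ⟩
        Λyz + (avoid y + Λxz)    ≡⟨ +-assoc Λyz (avoid y) Λxz ⟨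
        (Λyz + avoid y) + Λxz    ≡⟨ cong (_+ Λxz) (degree-split y z) ⟨
        degree y + Λxz           ∎
        where
        open ≡-Reasoning
        Λxz = pairDegree x z
        Λyz = pairDegree y z
        avoid : Fin n → ℕ
        avoid v = countAvoiding S i (v ∈ᵇ_) z
        avoider = every-card-avoided z
        avoid-x≡avoid-y : avoid x ≡ avoid y
        avoid-x≡avoid-y =
          countAvoiding-uniform′ (proj₁ (proj₂ avoider)) (proj₂ (proj₂ avoider)) (≢-sym z≢x) (≢-sym z≢y)

    pairDegree-transfer : Informative S (n ∸ 4) → ∀ {x y w} → x ≢ y → w ≢ x → w ≢ y →
                          0 < pairDegree x w → 0 < pairDegree y w
    pairDegree-transfer informative {x} {y} {w} x≢y w≢x w≢y 0<Λxw with pairDegree y w in Λyw≡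
    ... | suc _ = s≤s z≤n
    ... | zero = contradiction (+-cancelˡ-≤ (degree x) 1 0 (begin
      degree x + 1               ≤⟨ +-monoʳ-≤ (degree x) 0<Λys ⟩
      degree x + pairDegree y s  ≡⟨ balance H₀∈𝒜 s≢x s≢y ⟩
      degree y + pairDegree x s  ≤⟨ +-monoʳ-≤ (degree y) (pairDegree≤1 informative (≢-sym s≢x)) ⟩
      degree y + 1               ≤⟨ +-monoʳ-≤ (degree y) 0<Λxw ⟩
      degree y + pairDegree x w  ≡⟨ balance H₀∈𝒜 w≢x w≢y ⟨
      degree x + pairDegree y w  ≡⟨ cong (degree x +_) Λyw≡ ⟩
      degree x + 0               ∎)) λ ()
      where
      open ≤-Reasoning
      H₀∈𝒜 = proj₁ (proj₂ (0<pairDegree⇒hand 0<Λxw))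
      covering = every-card-covered H₀∈𝒜 x≢y
      H = proj₁ covering
      H∈𝒜 = proj₁ (proj₂ covering)
      y∈H = proj₁ (proj₂ (proj₂ covering))
      third = 2<∣p∣⇒∃-third {p = H} (subst (2 <_) (sym (ann-hands i H H∈𝒜)) (n<1+n 2)) x y
      s = proj₁ third
      s≢x = proj₁ (proj₂ (proj₂ third))
      s≢y = proj₂ (proj₂ (proj₂ third))
      0<Λys : 0 < pairDegree y s
      0<Λys = hand⇒0<pairDegree H∈𝒜 y∈H (proj₁ (proj₂ third))

  throughᵇ : Fin n → Subset n → Bool
  throughᵇ x H = ann i H ∧ (x ∈ᵇ H)

  ∈N⇒0<pairDegree : ∀ {x w} → w ∈ N S i x → w ≢ x × 0 < pairDegree x w
  ∈N⇒0<pairDegree {x} {w} w∈Nx =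
    let H , H∈filter , w∈H = x∈⋃⁻ (filterᵇ (throughᵇ x) (allSubsets n)) (p─q⊆p _ ⁅ x ⁆ w∈Nx)
        H∈𝒜 , x∈ᵇH = ∧≡true⁻ (Equivalence.to T-≡ (proj₂ (∈-filter⁻ (T? ∘ throughᵇ x) {xs = allSubsets n} H∈filter)))
    in x∉⁅y⁆⇒x≢y (x∈p─q⇒x∉q _ ⁅ x ⁆ w∈Nx) , hand⇒0<pairDegree H∈𝒜 (∈ᵇ⇒∈ x∈ᵇH) w∈H

  0<pairDegree⇒∈N : ∀ {x w} → w ≢ x → 0 < pairDegree x w → w ∈ N S i x
  0<pairDegree⇒∈N {x} {w} w≢x 0<Λxw =
    let H , H∈𝒜 , x∈H , w∈H = 0<pairDegree⇒hand 0<Λxw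
        H∈filter = ∈-filter⁺ (T? ∘ throughᵇ x) (∈-allSubsets H)
                     (Equivalence.from T-≡ (cong₂ _∧_ H∈𝒜 (∈⇒∈ᵇ x∈H)))
    in x∈p∧x∉q⇒x∈p─q (x∈⋃⁺ H∈filter w∈H) (x≢y⇒x∉⁅y⁆ w≢x)

  N─⁅⁆⊆N─⁅⁆ : 4 < n → Equitable S → Informative S (n ∸ 4) → PerfectlySecure S (n ∸ 4) 1 →
              ∀ {x y} → x ≢ y → N S i x ─ ⁅ y ⁆ ⊆ N S i y ─ ⁅ x ⁆
  N─⁅⁆⊆N─⁅⁆ 4<n equitable informative secure {x} {y} x≢y w∈ =
    let w≢x , 0<Λxw = ∈N⇒0<pairDegree (p─q⊆p _ ⁅ y ⁆ w∈)
        w≢y = x∉⁅y⁆⇒x≢y (x∈p─q⇒x∉q _ ⁅ y ⁆ w∈)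
        0<Λyw = pairDegree-transfer 4<n equitable secure informative x≢y w≢x w≢y 0<Λxw
    in x∈p∧x∉q⇒x∈p─q (0<pairDegree⇒∈N w≢y 0<Λyw) (x≢y⇒x∉⁅y⁆ w≢x)

lemma8 : (n : ℕ) → 1 ≤ n ∸ 4 → (S : Strategy n 3) →
         Equitable S → Informative S (n ∸ 4) → PerfectlySecure S (n ∸ 4) 1 →
         (i : Fin (Strategy.m S)) (x y : Fin n) → x ≢ y →
         N S i x ─ ⁅ y ⁆ ≡ N S i y ─ ⁅ x ⁆
lemma8 n 0<n∸4 S equitable informative secure i x y x≢y =
  ⊆-antisym (N─⁅⁆⊆N─⁅⁆ S i 4<n equitable informative secure x≢y)
            (N─⁅⁆⊆N─⁅⁆ S i 4<n equitable informative secure (≢-sym x≢y))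
  where
  4<n : 4 < n
  4<n = m∸n≢0⇒n<m (>⇒≢ 0<n∸4)
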